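{- Let $t$ be a positive integer. Then \[ \det(xI-A(T_t))=x^{t+2}-\sum_{i=1}^{t}\binom{t}{i} x^{t-i}. \]
   Context: $T_t$ is the tournament on vertex set $\{0,1,\dots,t+1\}$ in which, for $0\leqslant i<j\leqslant t+1$, there is an arc from $i$ to $j$, except for the pair $(i,j)=(0,t+1)$, where instead there is an arc from $t+1$ to $0$. $A(T_t)$ is its adjacency matrix ($(i,j)$-entry $1$ iff $(i,j)$ is an arc). -}

module Defs where

open import Data.Nat as ℕ using (ℕ; zero; suc; _<ᵇ_; _≡ᵇ_)
open import Data.Nat.Combinatorics using (_C_)
open import Data.Bool using (Bool; true; false; if_then_else_; not; _∧_)
open import Data.Fin using (Fin; zero; suc; toℕ; punchIn)
open import Data.Integer using (ℤ; +_; _+_; _-_; _*_; -_; _^_)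

Σᶠ : ∀ {n} → (Fin n → ℤ) → ℤ
Σᶠ {zero}  f = + 0
Σᶠ {suc n} f = f zero + Σᶠ (λ i → f (suc i))

sgn : ℕ → ℤ
sgn k = (- + 1) ^ k

det : ∀ n → (Fin n → Fin n → ℤ) → ℤ
det zero    M = + 1
det (suc n) M =
  Σᶠ (λ j → sgn (toℕ j) * M zero j * det n (λ i k → M (suc i) (punchIn j k)))

arc : (t : ℕ) → Fin (suc (suc t)) → Fin (suc (suc t)) → Bool
arc t i j =
  if toℕ i <ᵇ toℕ j
  then not ((toℕ i ≡ᵇ 0) ∧ (toℕ j ≡ᵇ suc t))
  else ((toℕ i ≡ᵇ suc t) ∧ (toℕ j ≡ᵇ 0))

A : (t : ℕ) → Fin (suc (suc t)) → Fin (suc (suc t)) → ℤ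
A t i j = if arc t i j then + 1 else + 0

I : ∀ {n} → Fin n → Fin n → ℤ
I i j = if toℕ i ≡ᵇ toℕ j then + 1 else + 0

charMat : (t : ℕ) → ℤ → Fin (suc (suc t)) → Fin (suc (suc t)) → ℤ
charMat t x i j = x * I i j - A t i j

rhs : ℕ → ℤ → ℤ
rhs t x = x ^ (t ℕ.+ 2) - Σᶠ {t} (λ k → + (t C suc (toℕ k)) * x ^ (t ℕ.∸ suc (toℕ k)))

{-# OPTIONS --safe #-}

-- Expand det (x I − A(T_t)) along its last row (−1, 0, …, 0, x). The cofactor of x is an upper
-- triangular determinant with diagonal x, i.e. x^(t+1). The cofactor of −1 is H_t(0), where H_s(a)
-- is the (s+1)×(s+1) Hessenberg matrix with first row (−1, …, −1, a), x on the subdiagonal and −1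
-- on and above the diagonal below the first row. Expanding H_(s+1)(a) along its last row
-- (0, …, 0, x, −1) gives H_(s+1)(a) = −x H_s(a) − H_s(−1), hence H_s(a) = (−1)^s ((a+1) x^s − (1+x)^s)
-- and det (x I − A(T_t)) = x^(t+2) − ((1+x)^t − x^t); the binomial theorem expands the bracket.

module Submission where

open import Defs
open import Data.Nat using (ℕ; suc; _≤_)
open import Data.Integer using (ℤ)
open import Relation.Binary.PropositionalEquality using (_≡_)

open import Data.Nat as ℕ using (zero; _<_; _≡ᵇ_; _<ᵇ_; _∸_; s≤s)
import Data.Nat.Properties as ℕP
open import Data.Nat.Combinatorics using (_C_)
open import Data.Bool using (true; false; if_then_else_; not; _∧_)
open import Data.Bool.Properties using (∧-zeroʳ; if-float)
open import Data.Integer using (+_; _+_; _-_; _*_; -_; _^_; 0ℤ; 1ℤ; -1ℤ)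
import Data.Integer.Properties as ℤP
open import Data.Integer.Tactic.RingSolver using (solve-∀)
open import Data.Fin using (Fin; zero; suc; toℕ; fromℕ; fromℕ<; inject₁; punchIn; punchOut; _≟_)
open import Data.Fin.Properties
  using (toℕ-fromℕ; toℕ-fromℕ<; toℕ-inject₁; toℕ-injective; toℕ<n; toℕ≤pred[n];
         fromℕ≢inject₁; punchIn-injective; punchInᵢ≢i; punchIn-punchOut)
open import Data.Vec.Functional using (updateAt)
open import Data.Vec.Functional.Properties using (updateAt-updates; updateAt-minimal)
open import Data.Sum using (inj₁; inj₂)
open import Function using (_∘_)
open import Relation.Binary.PropositionalEquality
  using (_≢_; refl; sym; trans; cong; cong₂; cong-app; module ≡-Reasoning)
open import Relation.Nullary using (yes; no; contradiction)
open import Algebra.Properties.Semiring.Sum ℤP.+-*-semiring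
  using (sum; sum-cong-≗; sum-replicate-zero; sum-remove; ∑-distrib-+; *-distribˡ-sum)
import Algebra.Properties.CommutativeSemiring.Binomial ℤP.+-*-commutativeSemiring as Binomial
import Algebra.Properties.Semiring.Exp ℤP.+-*-semiring as Exp
import Algebra.Properties.Semiring.Mult ℤP.+-*-semiring as Mult

open ≡-Reasoning

Matrix : ℕ → Set
Matrix n = Fin n → Fin n → ℤ

firstMinor lastMinor : ∀ {n} → Matrix (suc n) → Fin (suc n) → Matrix n
firstMinor M j i k = M (suc i) (punchIn j k)
lastMinor  M j i k = M (inject₁ i) (punchIn j k)

laplaceTerm : ∀ n → Matrix (suc n) → Fin (suc n) → ℤ
laplaceTerm n M j = sgn (toℕ j) * M zero j * det n (firstMinor M j)

Σᶠ≡sum : ∀ {n} (f : Fin n → ℤ) → Σᶠ f ≡ sum f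
Σᶠ≡sum {zero}  f = refl
Σᶠ≡sum {suc n} f = cong (λ s → f zero + s) (Σᶠ≡sum (f ∘ suc))

det-suc : ∀ n (M : Matrix (suc n)) → det (suc n) M ≡ sum (laplaceTerm n M)
det-suc n M = Σᶠ≡sum (laplaceTerm n M)

det-1 : (M : Matrix 1) → det 1 M ≡ M zero zero
det-1 M = trans (ℤP.+-identityʳ _) (trans (ℤP.*-identityʳ _) (ℤP.*-identityˡ _))

det-cong : ∀ n {M N : Matrix n} → (∀ i k → M i k ≡ N i k) → det n M ≡ det n N
det-cong zero    M≗N = refl
det-cong (suc n) {M} {N} M≗N =
  trans (det-suc n M) (trans (sum-cong-≗ term≡) (sym (det-suc n N)))
  where
  term≡ : ∀ j → laplaceTerm n M j ≡ laplaceTerm n N j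
  term≡ j = cong₂ (λ a d → sgn (toℕ j) * a * d) (M≗N zero j)
                  (det-cong n (λ i k → M≗N (suc i) (punchIn j k)))

sgn-suc : ∀ n → sgn (suc n) ≡ - sgn n
sgn-suc n = ℤP.-1*i≡-i (sgn n)

sgn-+ : ∀ m n → sgn (m ℕ.+ n) ≡ sgn m * sgn n
sgn-+ = ℤP.^-distribˡ-+-* -1ℤ

sgn-*-self : ∀ n → sgn n * sgn n ≡ 1ℤ
sgn-*-self zero    = refl
sgn-*-self (suc n) = begin
  sgn (suc n) * sgn (suc n)  ≡⟨ cong₂ _*_ (sgn-suc n) (sgn-suc n) ⟩
  - sgn n * - sgn n          ≡⟨ neg*neg (sgn n) ⟩
  sgn n * sgn n              ≡⟨ sgn-*-self n ⟩
  1ℤ                         ∎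
  where
  neg*neg : ∀ s → - s * - s ≡ s * s
  neg*neg = solve-∀

sgn-+-self : ∀ n → sgn (n ℕ.+ n) ≡ 1ℤ
sgn-+-self n = trans (sgn-+ n n) (sgn-*-self n)

sgn-suc-+-suc : ∀ m n → sgn (suc m ℕ.+ suc n) ≡ sgn (m ℕ.+ n)
sgn-suc-+-suc m n = begin
  sgn (suc (m ℕ.+ suc n))  ≡⟨ cong (sgn ∘ suc) (ℕP.+-suc m n) ⟩
  sgn (suc (suc (m ℕ.+ n))) ≡⟨ sgn-suc (suc (m ℕ.+ n)) ⟩
  - sgn (suc (m ℕ.+ n))    ≡⟨ cong -_ (sgn-suc (m ℕ.+ n)) ⟩
  - - sgn (m ℕ.+ n)        ≡⟨ ℤP.neg-involutive _ ⟩
  sgn (m ℕ.+ n)            ∎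

det-lastRow-zero : ∀ n (M : Matrix (suc n)) → (∀ k → M (fromℕ n) k ≡ 0ℤ) → det (suc n) M ≡ 0ℤ
det-lastRow-zero zero    M zeroRow = trans (det-1 M) (zeroRow zero)
det-lastRow-zero (suc n) M zeroRow = begin
  det (suc (suc n)) M       ≡⟨ det-suc (suc n) M ⟩
  sum (laplaceTerm _ M)     ≡⟨ sum-cong-≗ term≡0 ⟩
  sum {suc (suc n)} (λ _ → 0ℤ) ≡⟨ sum-replicate-zero (suc (suc n)) ⟩
  0ℤ                        ∎
  where
  term≡0 : ∀ j → laplaceTerm (suc n) M j ≡ 0ℤ
  term≡0 j = trans (cong (sgn (toℕ j) * M zero j *_)
                         (det-lastRow-zero n (firstMinor M j) (zeroRow ∘ punchIn j)))
                   (ℤP.*-zeroʳ (sgn (toℕ j) * M zero j))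

det-lastRow-+ : ∀ n (M M₁ M₂ : Matrix (suc n)) →
                (∀ i k → M (inject₁ i) k ≡ M₁ (inject₁ i) k) →
                (∀ i k → M (inject₁ i) k ≡ M₂ (inject₁ i) k) →
                (∀ k → M (fromℕ n) k ≡ M₁ (fromℕ n) k + M₂ (fromℕ n) k) →
                det (suc n) M ≡ det (suc n) M₁ + det (suc n) M₂
det-lastRow-+ zero M M₁ M₂ _ _ lastRow+ = begin
  det 1 M                    ≡⟨ det-1 M ⟩
  M zero zero                ≡⟨ lastRow+ zero ⟩
  M₁ zero zero + M₂ zero zero ≡⟨ sym (cong₂ _+_ (det-1 M₁) (det-1 M₂)) ⟩
  det 1 M₁ + det 1 M₂        ∎
det-lastRow-+ (suc n) M M₁ M₂ rows₁ rows₂ lastRow+ = begin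
  det (suc (suc n)) M                                      ≡⟨ det-suc (suc n) M ⟩
  sum (laplaceTerm _ M)                                    ≡⟨ sum-cong-≗ term+ ⟩
  sum (λ j → laplaceTerm _ M₁ j + laplaceTerm _ M₂ j)      ≡⟨ ∑-distrib-+ (laplaceTerm _ M₁) (laplaceTerm _ M₂) ⟩
  sum (laplaceTerm _ M₁) + sum (laplaceTerm _ M₂)          ≡⟨ sym (cong₂ _+_ (det-suc (suc n) M₁) (det-suc (suc n) M₂)) ⟩
  det (suc (suc n)) M₁ + det (suc (suc n)) M₂              ∎
  where
  term+ : ∀ j → laplaceTerm (suc n) M j ≡ laplaceTerm (suc n) M₁ j + laplaceTerm (suc n) M₂ j
  term+ j = begin
    s * M zero j * det (suc n) (firstMinor M j)
      ≡⟨ cong (s * M zero j *_) (det-lastRow-+ n (firstMinor M j) (firstMinor M₁ j) (firstMinor M₂ j)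
                                   (λ i k → rows₁ (suc i) (punchIn j k)) (λ i k → rows₂ (suc i) (punchIn j k))
                                   (lastRow+ ∘ punchIn j)) ⟩
    s * M zero j * (d₁ + d₂)
      ≡⟨ ℤP.*-distribˡ-+ (s * M zero j) d₁ d₂ ⟩
    s * M zero j * d₁ + s * M zero j * d₂
      ≡⟨ cong₂ (λ a₁ a₂ → s * a₁ * d₁ + s * a₂ * d₂) (rows₁ zero j) (rows₂ zero j) ⟩
    s * M₁ zero j * d₁ + s * M₂ zero j * d₂ ∎
    where
    s d₁ d₂ : ℤ
    s  = sgn (toℕ j)
    d₁ = det (suc n) (firstMinor M₁ j)
    d₂ = det (suc n) (firstMinor M₂ j)

punchIn-punchIn-punchOut : ∀ {n} (j : Fin (suc (suc n))) k (p : punchIn j k ≢ j) l →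
                           punchIn (punchIn j k) (punchIn (punchOut p) l) ≡ punchIn j (punchIn k l)
punchIn-punchIn-punchOut zero    k       p l       = refl
punchIn-punchIn-punchOut (suc j) zero    p l       = refl
punchIn-punchIn-punchOut (suc j) (suc k) p zero    = refl
punchIn-punchIn-punchOut (suc j) (suc k) p (suc l) = cong suc (punchIn-punchIn-punchOut j k (p ∘ cong suc) l)

sgn-punchIn-punchOut : ∀ {n} (j : Fin (suc n)) k (p : punchIn j k ≢ j) →
                       sgn (toℕ (punchIn j k) ℕ.+ toℕ (punchOut p)) ≡ - sgn (toℕ j ℕ.+ toℕ k)
sgn-punchIn-punchOut {suc n} zero k p = begin
  sgn (suc (toℕ k) ℕ.+ 0)  ≡⟨ cong sgn (ℕP.+-identityʳ (suc (toℕ k))) ⟩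
  sgn (suc (toℕ k))        ≡⟨ sgn-suc (toℕ k) ⟩
  - sgn (toℕ k)            ∎
sgn-punchIn-punchOut (suc j) zero p = begin
  sgn (toℕ j)                    ≡⟨ sym (ℤP.neg-involutive _) ⟩
  - - sgn (toℕ j)                ≡⟨ cong -_ (sym (sgn-suc (toℕ j))) ⟩
  - sgn (suc (toℕ j))            ≡⟨ cong (-_ ∘ sgn) (sym (ℕP.+-identityʳ (suc (toℕ j)))) ⟩
  - sgn (suc (toℕ j) ℕ.+ 0)      ∎
sgn-punchIn-punchOut (suc j) (suc k) p = begin
  sgn (suc (toℕ (punchIn j k)) ℕ.+ suc (toℕ (punchOut (p ∘ cong suc))))
    ≡⟨ sgn-suc-+-suc (toℕ (punchIn j k)) (toℕ (punchOut (p ∘ cong suc))) ⟩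
  sgn (toℕ (punchIn j k) ℕ.+ toℕ (punchOut (p ∘ cong suc)))
    ≡⟨ sgn-punchIn-punchOut j k (p ∘ cong suc) ⟩
  - sgn (toℕ j ℕ.+ toℕ k)
    ≡⟨ cong -_ (sym (sgn-suc-+-suc (toℕ j) (toℕ k))) ⟩
  - sgn (suc (toℕ j) ℕ.+ suc (toℕ k)) ∎

det-lastRow-single : ∀ n (M : Matrix (suc n)) j → (∀ k → k ≢ j → M (fromℕ n) k ≡ 0ℤ) →
                     det (suc n) M ≡ sgn (n ℕ.+ toℕ j) * M (fromℕ n) j * det n (lastMinor M j)
det-lastRow-single zero    M zero _ = trans (det-1 M) (sym (trans (ℤP.*-identityʳ _) (ℤP.*-identityˡ _)))
det-lastRow-single (suc m) M j zeroElsewhere = begin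
  det (suc (suc m)) M
    ≡⟨ det-suc (suc m) M ⟩
  sum (laplaceTerm _ M)
    ≡⟨ sum-remove {i = j} (laplaceTerm _ M) ⟩
  laplaceTerm _ M j + sum (laplaceTerm _ M ∘ punchIn j)
    ≡⟨ cong₂ _+_ term-j≡0 (sum-cong-≗ term-punchIn) ⟩
  0ℤ + sum (λ k → c * laplaceTerm m (lastMinor M j) k)
    ≡⟨ ℤP.+-identityˡ _ ⟩
  sum (λ k → c * laplaceTerm m (lastMinor M j) k)
    ≡⟨ sym (*-distribˡ-sum c (laplaceTerm m (lastMinor M j))) ⟩
  c * sum (laplaceTerm m (lastMinor M j))
    ≡⟨ cong (c *_) (sym (det-suc m (lastMinor M j))) ⟩
  c * det (suc m) (lastMinor M j) ∎
  where
  e c : ℤ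
  e = M (fromℕ (suc m)) j
  c = sgn (suc m ℕ.+ toℕ j) * e

  term-j≡0 : laplaceTerm (suc m) M j ≡ 0ℤ
  term-j≡0 = trans (cong (sgn (toℕ j) * M zero j *_)
                         (det-lastRow-zero m (firstMinor M j) (λ k → zeroElsewhere (punchIn j k) (punchInᵢ≢i j k))))
                   (ℤP.*-zeroʳ (sgn (toℕ j) * M zero j))

  regroup₁ : ∀ sᵢ a sₘ sₒ e D → sᵢ * a * (sₘ * sₒ * e * D) ≡ sᵢ * sₒ * (sₘ * e * (a * D))
  regroup₁ = solve-∀
  regroup₂ : ∀ sⱼ sₖ sₘ e a D → - (sⱼ * sₖ) * (sₘ * e * (a * D)) ≡ - (sₘ * sⱼ) * e * (sₖ * a * D)
  regroup₂ = solve-∀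

  term-punchIn : ∀ k → laplaceTerm (suc m) M (punchIn j k) ≡ c * laplaceTerm m (lastMinor M j) k
  term-punchIn k = begin
    sgn (toℕ jₖ) * a * det (suc m) (firstMinor M jₖ)
      ≡⟨ cong (sgn (toℕ jₖ) * a *_) (det-lastRow-single m (firstMinor M jₖ) o zeroElsewhereₖ) ⟩
    sgn (toℕ jₖ) * a * (sgn (m ℕ.+ toℕ o) * M (fromℕ (suc m)) (punchIn jₖ o) * det m (lastMinor (firstMinor M jₖ) o))
      ≡⟨ cong₂ (λ e′ d → sgn (toℕ jₖ) * a * (sgn (m ℕ.+ toℕ o) * e′ * d))
               (cong (M (fromℕ (suc m))) (punchIn-punchOut p))
               (det-cong m (λ i l → cong (M (suc (inject₁ i))) (punchIn-punchIn-punchOut j k p l))) ⟩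
    sgn (toℕ jₖ) * a * (sgn (m ℕ.+ toℕ o) * e * D)
      ≡⟨ cong (λ s → sgn (toℕ jₖ) * a * (s * e * D)) (sgn-+ m (toℕ o)) ⟩
    sgn (toℕ jₖ) * a * (sgn m * sgn (toℕ o) * e * D)
      ≡⟨ regroup₁ (sgn (toℕ jₖ)) a (sgn m) (sgn (toℕ o)) e D ⟩
    sgn (toℕ jₖ) * sgn (toℕ o) * (sgn m * e * (a * D))
      ≡⟨ cong (_* (sgn m * e * (a * D))) parity ⟩
    - (sgn (toℕ j) * sgn (toℕ k)) * (sgn m * e * (a * D))
      ≡⟨ regroup₂ (sgn (toℕ j)) (sgn (toℕ k)) (sgn m) e a D ⟩
    - (sgn m * sgn (toℕ j)) * e * (sgn (toℕ k) * a * D)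
      ≡⟨ cong (λ s → s * e * (sgn (toℕ k) * a * D)) (sym (trans (sgn-suc (m ℕ.+ toℕ j)) (cong -_ (sgn-+ m (toℕ j))))) ⟩
    c * (sgn (toℕ k) * a * D) ∎
    where
    jₖ : Fin (suc (suc m))
    jₖ = punchIn j k
    p : jₖ ≢ j
    p  = punchInᵢ≢i j k
    -- column j of M is column o of firstMinor M jₖ
    o : Fin (suc m)
    o  = punchOut p
    a D : ℤ
    a  = M zero jₖ
    D  = det m (firstMinor (lastMinor M j) k)

    zeroElsewhereₖ : ∀ l → l ≢ o → firstMinor M jₖ (fromℕ m) l ≡ 0ℤ
    zeroElsewhereₖ l l≢o = zeroElsewhere (punchIn jₖ l)
      (λ eq → l≢o (punchIn-injective jₖ l o (trans eq (sym (punchIn-punchOut p)))))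

    parity : sgn (toℕ jₖ) * sgn (toℕ o) ≡ - (sgn (toℕ j) * sgn (toℕ k))
    parity = trans (sym (sgn-+ (toℕ jₖ) (toℕ o)))
                   (trans (sgn-punchIn-punchOut j k p) (cong -_ (sgn-+ (toℕ j) (toℕ k))))

det-lastRow-pair : ∀ n (M : Matrix (suc n)) {j j′} → j ≢ j′ →
                   (∀ k → k ≢ j → k ≢ j′ → M (fromℕ n) k ≡ 0ℤ) →
                   det (suc n) M ≡ sgn (n ℕ.+ toℕ j)  * M (fromℕ n) j  * det n (lastMinor M j)
                                 + sgn (n ℕ.+ toℕ j′) * M (fromℕ n) j′ * det n (lastMinor M j′)
det-lastRow-pair n M {j} {j′} j≢j′ zeroElsewhere =
  trans (det-lastRow-+ n M (keepOnly j) (keepOnly j′)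
                       (λ i k → sym (keepOnly-inject₁ j i k)) (λ i k → sym (keepOnly-inject₁ j′ i k)) split)
        (cong₂ _+_ (expand j) (expand j′))
  where
  keepOnly : Fin (suc n) → Matrix (suc n)
  keepOnly l = updateAt M (fromℕ n) (λ _ → updateAt (λ _ → 0ℤ) l (λ _ → M (fromℕ n) l))

  keepOnly-inject₁ : ∀ l i k → keepOnly l (inject₁ i) k ≡ M (inject₁ i) k
  keepOnly-inject₁ l i = cong-app (updateAt-minimal (inject₁ i) (fromℕ n) M (fromℕ≢inject₁ ∘ sym))

  keepOnly-at : ∀ l → keepOnly l (fromℕ n) l ≡ M (fromℕ n) l
  keepOnly-at l = trans (cong-app (updateAt-updates (fromℕ n) M) l) (updateAt-updates l (λ _ → 0ℤ))

  keepOnly-off : ∀ {l k} → k ≢ l → keepOnly l (fromℕ n) k ≡ 0ℤ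
  keepOnly-off {l} {k} k≢l = trans (cong-app (updateAt-updates (fromℕ n) M) k) (updateAt-minimal k l (λ _ → 0ℤ) k≢l)

  split : ∀ k → M (fromℕ n) k ≡ keepOnly j (fromℕ n) k + keepOnly j′ (fromℕ n) k
  split k with k ≟ j | k ≟ j′
  ... | yes refl | _        = sym (trans (cong₂ _+_ (keepOnly-at k) (keepOnly-off j≢j′)) (ℤP.+-identityʳ _))
  ... | no k≢j   | yes refl = sym (trans (cong₂ _+_ (keepOnly-off k≢j) (keepOnly-at k)) (ℤP.+-identityˡ _))
  ... | no k≢j   | no k≢j′  = trans (zeroElsewhere k k≢j k≢j′) (sym (cong₂ _+_ (keepOnly-off k≢j) (keepOnly-off k≢j′)))

  expand : ∀ l → det (suc n) (keepOnly l) ≡ sgn (n ℕ.+ toℕ l) * M (fromℕ n) l * det n (lastMinor M l)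
  expand l = trans (det-lastRow-single n (keepOnly l) l (λ _ → keepOnly-off))
                   (cong₂ (λ e d → sgn (n ℕ.+ toℕ l) * e * d) (keepOnly-at l)
                          (det-cong n (λ i k → keepOnly-inject₁ l i (punchIn l k))))

tab : ∀ n → (ℕ → ℕ → ℤ) → Matrix n
tab n f i k = f (toℕ i) (toℕ k)

punchInℕ : ℕ → ℕ → ℕ
punchInℕ zero    c       = suc c
punchInℕ (suc j) zero    = zero
punchInℕ (suc j) (suc c) = suc (punchInℕ j c)

toℕ-punchIn : ∀ {n} (j : Fin (suc n)) k → toℕ (punchIn j k) ≡ punchInℕ (toℕ j) (toℕ k)
toℕ-punchIn zero    k       = refl
toℕ-punchIn (suc j) zero    = refl
toℕ-punchIn (suc j) (suc k) = cong suc (toℕ-punchIn j k)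

punchInℕ-< : ∀ {j c} → c < j → punchInℕ j c ≡ c
punchInℕ-< {suc j} {zero}  _         = refl
punchInℕ-< {suc j} {suc c} (s≤s c<j) = cong suc (punchInℕ-< c<j)

punchInℕ-≥ : ∀ {j c} → j ≤ c → punchInℕ j c ≡ suc c
punchInℕ-≥ {zero}            _         = refl
punchInℕ-≥ {suc j} {suc c} (s≤s j≤c) = cong suc (punchInℕ-≥ j≤c)

lastMinor-tab : ∀ n f (j : Fin (suc n)) i k →
                lastMinor (tab (suc n) f) j i k ≡ tab n (λ r c → f r (punchInℕ (toℕ j) c)) i k
lastMinor-tab n f j i k = cong₂ f (toℕ-inject₁ i) (toℕ-punchIn j k)

det-tab-cong : ∀ n {f g : ℕ → ℕ → ℤ} → (∀ {r c} → r < n → c < n → f r c ≡ g r c) →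
               det n (tab n f) ≡ det n (tab n g)
det-tab-cong n f≈g = det-cong n (λ i k → f≈g (toℕ<n i) (toℕ<n k))

tab-fromℕ : ∀ n (f : ℕ → ℕ → ℤ) k → tab (suc n) f (fromℕ n) k ≡ f n (toℕ k)
tab-fromℕ n f k = cong (λ r → f r (toℕ k)) (toℕ-fromℕ n)

toℕ-≢ : ∀ {n} {j k : Fin n} {a} → toℕ j ≡ a → k ≢ j → toℕ k ≢ a
toℕ-≢ toℕ-j k≢j eq = k≢j (toℕ-injective (trans eq (sym toℕ-j)))

lastRowTerm-tab : ∀ n f (j : Fin (suc n)) {a} → toℕ j ≡ a →
                  sgn (n ℕ.+ toℕ j) * tab (suc n) f (fromℕ n) j * det n (lastMinor (tab (suc n) f) j)
                  ≡ sgn (n ℕ.+ a) * f n a * det n (tab n (λ r c → f r (punchInℕ a c)))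
lastRowTerm-tab n f j refl = cong₂ (λ e d → sgn (n ℕ.+ toℕ j) * e * d)
                                   (tab-fromℕ n f j) (det-cong n (lastMinor-tab n f j))

det-tab-lastRow-diag : ∀ n (f : ℕ → ℕ → ℤ) → (∀ {c} → c < n → f n c ≡ 0ℤ) →
                       det (suc n) (tab (suc n) f) ≡ f n n * det n (tab n f)
det-tab-lastRow-diag n f belowDiag = begin
  det (suc n) (tab (suc n) f)
    ≡⟨ det-lastRow-single n (tab (suc n) f) (fromℕ n) zeroElsewhere ⟩
  sgn (n ℕ.+ toℕ (fromℕ n)) * tab (suc n) f (fromℕ n) (fromℕ n) * det n (lastMinor (tab (suc n) f) (fromℕ n))
    ≡⟨ lastRowTerm-tab n f (fromℕ n) (toℕ-fromℕ n) ⟩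
  sgn (n ℕ.+ n) * f n n * det n (tab n (λ r c → f r (punchInℕ n c)))
    ≡⟨ cong₂ (λ s d → s * f n n * d) (sgn-+-self n) (det-tab-cong n (λ {r} _ c<n → cong (f r) (punchInℕ-< c<n))) ⟩
  1ℤ * f n n * det n (tab n f)
    ≡⟨ cong (_* det n (tab n f)) (ℤP.*-identityˡ (f n n)) ⟩
  f n n * det n (tab n f) ∎
  where
  zeroElsewhere : ∀ k → k ≢ fromℕ n → tab (suc n) f (fromℕ n) k ≡ 0ℤ
  zeroElsewhere k k≢n =
    trans (tab-fromℕ n f k) (belowDiag (ℕP.≤∧≢⇒< (toℕ≤pred[n] k) (toℕ-≢ (toℕ-fromℕ n) k≢n)))

det-tab-lastRow-pair : ∀ n (f : ℕ → ℕ → ℤ) {a b} → a < b → b ≤ n →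
                       (∀ {c} → c ≤ n → c ≢ a → c ≢ b → f n c ≡ 0ℤ) →
                       det (suc n) (tab (suc n) f)
                       ≡ sgn (n ℕ.+ a) * f n a * det n (tab n (λ r c → f r (punchInℕ a c)))
                       + sgn (n ℕ.+ b) * f n b * det n (tab n (λ r c → f r (punchInℕ b c)))
det-tab-lastRow-pair n f {a} {b} a<b b≤n zeroElsewhere =
  trans (det-lastRow-pair n (tab (suc n) f) j≢j′ zeroElsewhereᶠ)
        (cong₂ _+_ (lastRowTerm-tab n f j toℕ-j) (lastRowTerm-tab n f j′ toℕ-j′))
  where
  j j′ : Fin (suc n)
  j  = fromℕ< (s≤s (ℕP.<⇒≤ (ℕP.<-≤-trans a<b b≤n)))
  j′ = fromℕ< (s≤s b≤n)
  toℕ-j : toℕ j ≡ a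
  toℕ-j = toℕ-fromℕ< _
  toℕ-j′ : toℕ j′ ≡ b
  toℕ-j′ = toℕ-fromℕ< _

  j≢j′ : j ≢ j′
  j≢j′ j≡j′ = ℕP.<⇒≢ a<b (trans (sym toℕ-j) (trans (cong toℕ j≡j′) toℕ-j′))

  zeroElsewhereᶠ : ∀ k → k ≢ j → k ≢ j′ → tab (suc n) f (fromℕ n) k ≡ 0ℤ
  zeroElsewhereᶠ k k≢j k≢j′ =
    trans (tab-fromℕ n f k) (zeroElsewhere (toℕ≤pred[n] k) (toℕ-≢ toℕ-j k≢j) (toℕ-≢ toℕ-j′ k≢j′))

≡ᵇ-refl : ∀ n → (n ≡ᵇ n) ≡ true
≡ᵇ-refl zero    = refl
≡ᵇ-refl (suc n) = ≡ᵇ-refl n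

<⇒≡ᵇ-false : ∀ {m n} → m < n → (m ≡ᵇ n) ≡ false
<⇒≡ᵇ-false {zero}  {suc n} _         = refl
<⇒≡ᵇ-false {suc m} {suc n} (s≤s m<n) = <⇒≡ᵇ-false m<n

Exp^≡^ : ∀ y n → y Exp.^ n ≡ y ^ n
Exp^≡^ y zero    = refl
Exp^≡^ y (suc n) = cong (y *_) (Exp^≡^ y n)

Mult×≡* : ∀ n y → n Mult.× y ≡ + n * y
Mult×≡* zero    y = refl
Mult×≡* (suc n) y = trans (cong (λ z → y + z) (Mult×≡* n y)) (sym (ℤP.suc-* (+ n) y))

binomial-tail : ∀ t x → (1ℤ + x) ^ t - x ^ t ≡ Σᶠ {t} (λ k → + (t C suc (toℕ k)) * x ^ (t ∸ suc (toℕ k)))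
binomial-tail t x = trans (cong (_- x ^ t) expansion) (cancel (x ^ t) S)
  where
  term : Fin t → ℤ
  term k = + (t C suc (toℕ k)) * x ^ (t ∸ suc (toℕ k))
  S : ℤ
  S = Σᶠ term

  cancel : ∀ X S → X + S - X ≡ S
  cancel = solve-∀

  first : Binomial.binomialTerm 1ℤ x t zero ≡ x ^ t
  first = trans (ℤP.+-identityʳ _) (trans (ℤP.*-identityˡ _) (Exp^≡^ x t))

  rest : ∀ k → Binomial.binomialTerm 1ℤ x t (suc k) ≡ term k
  rest k = trans (Mult×≡* (t C suc (toℕ k)) _)
                 (cong (+ (t C suc (toℕ k)) *_)
                       (trans (cong₂ _*_ (trans (Exp^≡^ 1ℤ (suc (toℕ k))) (ℤP.^-zeroˡ (suc (toℕ k))))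
                                         (Exp^≡^ x (t ∸ suc (toℕ k))))
                              (ℤP.*-identityˡ _)))

  expansion : (1ℤ + x) ^ t ≡ x ^ t + S
  expansion = begin
    (1ℤ + x) ^ t                        ≡⟨ sym (Exp^≡^ (1ℤ + x) t) ⟩
    (1ℤ + x) Exp.^ t                    ≡⟨ Binomial.theorem t 1ℤ x ⟩
    sum (Binomial.binomialTerm 1ℤ x t)  ≡⟨ cong₂ _+_ first (trans (sum-cong-≗ rest) (sym (Σᶠ≡sum term))) ⟩
    x ^ t + S                           ∎

module _ (x : ℤ) where

  upper : ℕ → ℕ → ℤ
  upper zero    zero    = x
  upper zero    (suc c) = -1ℤ
  upper (suc r) zero    = 0ℤ
  upper (suc r) (suc c) = upper r c

  upper-diag : ∀ r → upper r r ≡ x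
  upper-diag zero    = refl
  upper-diag (suc r) = upper-diag r

  upper-< : ∀ {r c} → r < c → upper r c ≡ -1ℤ
  upper-< {zero}  {suc c} _         = refl
  upper-< {suc r} {suc c} (s≤s r<c) = upper-< r<c

  upper-> : ∀ {r c} → c < r → upper r c ≡ 0ℤ
  upper-> {suc r} {zero}  _         = refl
  upper-> {suc r} {suc c} (s≤s c<r) = upper-> c<r

  det-upper : ∀ n → det n (tab n upper) ≡ x ^ n
  det-upper zero    = refl
  det-upper (suc n) = trans (det-tab-lastRow-diag n upper upper->) (cong₂ _*_ (upper-diag n) (det-upper n))

  topRow : ℕ → ℤ → ℕ → ℤ
  topRow zero    a zero    = a
  topRow zero    a (suc c) = -1ℤ
  topRow (suc s) a zero    = -1ℤ
  topRow (suc s) a (suc c) = topRow s a c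

  topRow-self : ∀ s {a} → topRow s a s ≡ a
  topRow-self zero    = refl
  topRow-self (suc s) = topRow-self s

  topRow-≢ : ∀ {s c a} → c ≢ s → topRow s a c ≡ -1ℤ
  topRow-≢ {zero}  {zero}  c≢s = contradiction refl c≢s
  topRow-≢ {zero}  {suc c} _   = refl
  topRow-≢ {suc s} {zero}  _   = refl
  topRow-≢ {suc s} {suc c} c≢s = topRow-≢ (c≢s ∘ cong suc)

  topRow-const : ∀ s c → topRow s -1ℤ c ≡ -1ℤ
  topRow-const zero    zero    = refl
  topRow-const zero    (suc c) = refl
  topRow-const (suc s) zero    = refl
  topRow-const (suc s) (suc c) = topRow-const s c

  hessenberg : ℕ → ℤ → ℕ → ℕ → ℤ
  hessenberg s a zero    = topRow s a
  hessenberg s a (suc r) = upper r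

  hessenberg-below-corner : ∀ {s a r c} → c < s → hessenberg (suc s) a r c ≡ hessenberg s a r c
  hessenberg-below-corner {r = zero}  c<s =
    trans (topRow-≢ (ℕP.<⇒≢ (ℕP.m≤n⇒m≤1+n c<s))) (sym (topRow-≢ (ℕP.<⇒≢ c<s)))
  hessenberg-below-corner {r = suc r} _   = refl

  hessenberg-corner : ∀ {s a r} → r < suc s → hessenberg (suc s) a r (suc s) ≡ hessenberg s a r s
  hessenberg-corner {s} {r = zero}  _     = trans (topRow-self (suc s)) (sym (topRow-self s))
  hessenberg-corner {s} {r = suc r} r<1+s = trans (upper-< (ℕP.m≤n⇒m≤1+n r<s)) (sym (upper-< r<s))
    where
    r<s : r < s
    r<s = ℕP.≤-pred r<1+s

  hessenberg-dropPenultimate : ∀ {s a r c} → r < suc s → c < suc s →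
                               hessenberg (suc s) a r (punchInℕ s c) ≡ hessenberg s a r c
  hessenberg-dropPenultimate {s} {a} {r} {c} r<1+s c<1+s with ℕP.m≤n⇒m<n∨m≡n (ℕP.≤-pred c<1+s)
  ... | inj₁ c<s  = trans (cong (hessenberg (suc s) a r) (punchInℕ-< c<s)) (hessenberg-below-corner {s} {a} {r} c<s)
  ... | inj₂ refl = trans (cong (hessenberg (suc s) a r) (punchInℕ-≥ (ℕP.≤-refl {s}))) (hessenberg-corner r<1+s)

  hessenberg-dropLast : ∀ {s a r c} → c < suc s →
                        hessenberg (suc s) a r (punchInℕ (suc s) c) ≡ hessenberg s -1ℤ r c
  hessenberg-dropLast {s} {r = zero}  {c} c<1+s =
    trans (cong (topRow (suc s) _) (punchInℕ-< c<1+s)) (trans (topRow-≢ (ℕP.<⇒≢ c<1+s)) (sym (topRow-const s c)))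
  hessenberg-dropLast {r = suc r} c<1+s = cong (upper r) (punchInℕ-< c<1+s)

  det-hessenberg : ∀ s a → det (suc s) (tab (suc s) (hessenberg s a))
                           ≡ sgn s * ((a + 1ℤ) * x ^ s - (1ℤ + x) ^ s)
  det-hessenberg zero    a = trans (det-1 (tab 1 (hessenberg 0 a))) (base a x)
    where
    base : ∀ a x → a ≡ 1ℤ * ((a + 1ℤ) * 1ℤ - 1ℤ)
    base = solve-∀
  det-hessenberg (suc s) a = begin
    det (suc (suc s)) (tab (suc (suc s)) (hessenberg (suc s) a))
      ≡⟨ det-tab-lastRow-pair (suc s) (hessenberg (suc s) a) (ℕP.n<1+n s) ℕP.≤-refl zeroElsewhere ⟩
    sgn (suc s ℕ.+ s) * upper s s * det (suc s) (tab (suc s) (λ r c → hessenberg (suc s) a r (punchInℕ s c)))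
    + sgn (suc s ℕ.+ suc s) * upper s (suc s)
      * det (suc s) (tab (suc s) (λ r c → hessenberg (suc s) a r (punchInℕ (suc s) c)))
      ≡⟨ cong₂ _+_ (cong₂ (λ e d → sgn (suc s ℕ.+ s) * e * d) (upper-diag s)
                          (det-tab-cong (suc s) (hessenberg-dropPenultimate {s} {a})))
                   (cong₂ (λ e d → sgn (suc s ℕ.+ suc s) * e * d) (upper-< (ℕP.n<1+n s))
                          (det-tab-cong (suc s) (λ {r} _ → hessenberg-dropLast {s} {a} {r}))) ⟩
    sgn (suc s ℕ.+ s) * x * det (suc s) (tab (suc s) (hessenberg s a))
    + sgn (suc s ℕ.+ suc s) * -1ℤ * det (suc s) (tab (suc s) (hessenberg s -1ℤ))
      ≡⟨ cong₂ (λ d d′ → sgn (suc s ℕ.+ s) * x * d + sgn (suc s ℕ.+ suc s) * -1ℤ * d′)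
               (det-hessenberg s a) (det-hessenberg s -1ℤ) ⟩
    sgn (suc s ℕ.+ s) * x * (sgn s * ((a + 1ℤ) * X - P))
    + sgn (suc s ℕ.+ suc s) * -1ℤ * (sgn s * ((-1ℤ + 1ℤ) * X - P))
      ≡⟨ cong₂ (λ u v → u * x * (sgn s * ((a + 1ℤ) * X - P)) + v * -1ℤ * (sgn s * ((-1ℤ + 1ℤ) * X - P)))
               (trans (sgn-suc (s ℕ.+ s)) (cong -_ (sgn-+-self s))) (sgn-+-self (suc s)) ⟩
    -1ℤ * x * (sgn s * ((a + 1ℤ) * X - P)) + 1ℤ * -1ℤ * (sgn s * ((-1ℤ + 1ℤ) * X - P))
      ≡⟨ recurrence (sgn s) a x X P ⟩
    - sgn s * ((a + 1ℤ) * (x * X) - (1ℤ + x) * P)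
      ≡⟨ cong (_* ((a + 1ℤ) * (x * X) - (1ℤ + x) * P)) (sym (sgn-suc s)) ⟩
    sgn (suc s) * ((a + 1ℤ) * x ^ suc s - (1ℤ + x) ^ suc s) ∎
    where
    X P : ℤ
    X = x ^ s
    P = (1ℤ + x) ^ s

    recurrence : ∀ σ a x X P → -1ℤ * x * (σ * ((a + 1ℤ) * X - P)) + 1ℤ * -1ℤ * (σ * ((-1ℤ + 1ℤ) * X - P))
                               ≡ - σ * ((a + 1ℤ) * (x * X) - (1ℤ + x) * P)
    recurrence = solve-∀

    zeroElsewhere : ∀ {c} → c ≤ suc s → c ≢ s → c ≢ suc s → hessenberg (suc s) a (suc s) c ≡ 0ℤ
    zeroElsewhere c≤1+s c≢s c≢1+s = upper-> (ℕP.≤∧≢⇒< (ℕP.≤-pred (ℕP.≤∧≢⇒< c≤1+s c≢1+s)) c≢s)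

  -- charMat t x is definitionally tab (2 + t) (charMatℕ t).
  charMatℕ : ℕ → ℕ → ℕ → ℤ
  charMatℕ t r c =
    x * (if r ≡ᵇ c then + 1 else + 0)
    - (if (if r <ᵇ c then not ((r ≡ᵇ 0) ∧ (c ≡ᵇ suc t)) else ((r ≡ᵇ suc t) ∧ (c ≡ᵇ 0))) then + 1 else + 0)

  x*0-0≡0 : x * 0ℤ - 0ℤ ≡ 0ℤ
  x*0-0≡0 = cong (_- 0ℤ) (ℤP.*-zeroʳ x)

  x*0-1≡-1 : x * 0ℤ - 1ℤ ≡ -1ℤ
  x*0-1≡-1 = cong (_- 1ℤ) (ℤP.*-zeroʳ x)

  upper-indicator : ∀ r c → x * (if r ≡ᵇ c then 1ℤ else 0ℤ) - (if r <ᵇ c then 1ℤ else 0ℤ) ≡ upper r c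
  upper-indicator zero    zero    = trans (ℤP.+-identityʳ (x * 1ℤ)) (ℤP.*-identityʳ x)
  upper-indicator zero    (suc c) = x*0-1≡-1
  upper-indicator (suc r) zero    = x*0-0≡0
  upper-indicator (suc r) (suc c) = upper-indicator r c

  topRow-indicator : ∀ t c → x * 0ℤ - (if not (c ≡ᵇ t) then 1ℤ else 0ℤ) ≡ topRow t 0ℤ c
  topRow-indicator zero    zero    = x*0-0≡0
  topRow-indicator zero    (suc c) = x*0-1≡-1
  topRow-indicator (suc t) zero    = x*0-1≡-1
  topRow-indicator (suc t) (suc c) = topRow-indicator t c

  charMatℕ-suc : ∀ t r c → charMatℕ t r (suc c) ≡ hessenberg t 0ℤ r c
  charMatℕ-suc t zero    c = topRow-indicator t c
  charMatℕ-suc t (suc r) c rewrite ∧-zeroʳ (r ≡ᵇ t) =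
    trans (cong (λ v → x * (if r ≡ᵇ c then 1ℤ else 0ℤ) - v) (if-float (λ b → if b then 1ℤ else 0ℤ) (r <ᵇ c)))
          (upper-indicator r c)

  charMatℕ-upper : ∀ {t r c} → r < suc t → c < suc t → charMatℕ t r c ≡ upper r c
  charMatℕ-upper {t} {zero}  {zero}  _   _   = upper-indicator zero zero
  charMatℕ-upper {t} {zero}  {suc c} _   c<n = trans (charMatℕ-suc t zero c) (topRow-≢ (ℕP.<⇒≢ (ℕP.≤-pred c<n)))
  charMatℕ-upper {t} {suc r} {suc c} _   _   = charMatℕ-suc t (suc r) c
  charMatℕ-upper {t} {suc r} {zero}  r<n _ rewrite <⇒≡ᵇ-false (ℕP.≤-pred r<n) = x*0-0≡0

  charMatℕ-corner : ∀ t → charMatℕ t (suc t) zero ≡ -1ℤ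
  charMatℕ-corner t rewrite ≡ᵇ-refl t = x*0-1≡-1

  det-charMat : ∀ t → det (suc (suc t)) (charMat t x) ≡ x * (x * x ^ t) - ((1ℤ + x) ^ t - x ^ t)
  det-charMat t = begin
    det (suc (suc t)) (tab (suc (suc t)) (charMatℕ t))
      ≡⟨ det-tab-lastRow-pair (suc t) (charMatℕ t) (s≤s ℕ.z≤n) ℕP.≤-refl zeroElsewhere ⟩
    sgn (suc t ℕ.+ 0) * charMatℕ t (suc t) 0 * det (suc t) (tab (suc t) (λ r c → charMatℕ t r (suc c)))
    + sgn (suc t ℕ.+ suc t) * charMatℕ t (suc t) (suc t)
      * det (suc t) (tab (suc t) (λ r c → charMatℕ t r (punchInℕ (suc t) c)))
      ≡⟨ cong₂ _+_ (cong₂ (λ e d → sgn (suc t ℕ.+ 0) * e * d) (charMatℕ-corner t)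
                          (det-cong (suc t) (λ i k → charMatℕ-suc t (toℕ i) (toℕ k))))
                   (cong₂ (λ e d → sgn (suc t ℕ.+ suc t) * e * d)
                          (trans (charMatℕ-suc t (suc t) t) (upper-diag t))
                          (det-tab-cong (suc t) (λ {r} r<n c<n → trans (cong (charMatℕ t r) (punchInℕ-< c<n))
                                                                       (charMatℕ-upper r<n c<n)))) ⟩
    sgn (suc t ℕ.+ 0) * -1ℤ * det (suc t) (tab (suc t) (hessenberg t 0ℤ))
    + sgn (suc t ℕ.+ suc t) * x * det (suc t) (tab (suc t) upper)
      ≡⟨ cong₂ (λ d d′ → sgn (suc t ℕ.+ 0) * -1ℤ * d + sgn (suc t ℕ.+ suc t) * x * d′)
               (det-hessenberg t 0ℤ) (det-upper (suc t)) ⟩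
    sgn (suc t ℕ.+ 0) * -1ℤ * (sgn t * ((0ℤ + 1ℤ) * X - P)) + sgn (suc t ℕ.+ suc t) * x * (x * X)
      ≡⟨ cong₂ (λ u v → u * -1ℤ * (sgn t * ((0ℤ + 1ℤ) * X - P)) + v * x * (x * X))
               (trans (cong sgn (ℕP.+-identityʳ (suc t))) (sgn-suc t)) (sgn-+-self (suc t)) ⟩
    - sgn t * -1ℤ * (sgn t * ((0ℤ + 1ℤ) * X - P)) + 1ℤ * x * (x * X)
      ≡⟨ regroup (sgn t) x X P ⟩
    sgn t * sgn t * (X - P) + x * (x * X)
      ≡⟨ cong (λ u → u * (X - P) + x * (x * X)) (sgn-*-self t) ⟩
    1ℤ * (X - P) + x * (x * X)
      ≡⟨ finish x X P ⟩
    x * (x * X) - (P - X) ∎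
    where
    X P : ℤ
    X = x ^ t
    P = (1ℤ + x) ^ t

    regroup : ∀ σ x X P → - σ * -1ℤ * (σ * ((0ℤ + 1ℤ) * X - P)) + 1ℤ * x * (x * X)
                          ≡ σ * σ * (X - P) + x * (x * X)
    regroup = solve-∀
    finish : ∀ x X P → 1ℤ * (X - P) + x * (x * X) ≡ x * (x * X) - (P - X)
    finish = solve-∀

    zeroElsewhere : ∀ {c} → c ≤ suc t → c ≢ 0 → c ≢ suc t → charMatℕ t (suc t) c ≡ 0ℤ
    zeroElsewhere {zero}  _     c≢0 _     = contradiction refl c≢0
    zeroElsewhere {suc c} c≤1+t _   c≢1+t =
      trans (charMatℕ-suc t (suc t) c) (upper-> (ℕP.≤-pred (ℕP.≤∧≢⇒< c≤1+t c≢1+t)))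

-- The identity also holds for t = 0.
lemma6p3 : (t : ℕ) → 1 ≤ t → (x : ℤ) → det (suc (suc t)) (charMat t x) ≡ rhs t x
lemma6p3 t _ x = begin
  det (suc (suc t)) (charMat t x)             ≡⟨ det-charMat x t ⟩
  x ^ (2 ℕ.+ t) - ((1ℤ + x) ^ t - x ^ t)      ≡⟨ cong₂ _-_ (cong (x ^_) (ℕP.+-comm 2 t)) (binomial-tail t x) ⟩
  rhs t x                                     ∎
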